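{- Let $G$ be a graph without isolated vertices, $B$ a $\wedge_d$-OBDD representing $\psi(G)$ and obeying a linear order $\pi^*$ of $V(G^*)$. Let $U=\{u_1,\dots,u_q\}$, $W=\{w_1,\dots,w_q\}\subseteq V(G)$ be such that $M=\{\{u_i[1],w_i[2]\}:1\le i\le q\}$ is an induced matching of $G^*$ and every element of $U[1]$ precedes every element of $W[2]$ in $\pi^*$. Let $\pi_0$ be the prefix of $\pi^*$ ending with the last element of $U[1]$ and let $\mathcal{F}$, $I(\cdot)$, $L(\cdot)$ be as defined in the context. Let ${\bf g}_1,{\bf g}_2$ be two distinct elements of $\mathcal{F}$, and for $j\in\{1,2\}$ let $u({\bf g}_j)$ be a node of $L({\bf g}_j)$ with $W[2]_{I({\bf g}_j)}\subseteq\mathsf{var}(B_{u({\bf g}_j)})$. Then $u({\bf g}_1)\neq u({\bf g}_2)$.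
   Context: $G^*$ has vertex set $V[1]\cup V[2]$ ($V[i]=\{v[i]:v\in V(G)\}$ disjoint copies of $V(G)$) and edges $\{u[1],v[2]\}$, $\{v[1],u[2]\}$ for each $\{u,v\}\in E(G)$; $U[i]=\{u[i]:u\in U\}$. $\psi(G)$ is the CNF on $V(G^*)$ with clause $(a\vee b)$ per edge $\{a,b\}$ of $G^*$ plus clauses $\bigvee_{v}\neg v[1]$ and $\bigvee_v\neg v[2]$. A matching is induced if there is no edge between endpoints of distinct matching edges. A $\wedge_d$-FBDD is a DAG $B$ with one source, sinks ${\bf 0},{\bf 1}$, decision nodes labelled by variables with out-edges labelled $0,1$, and conjunction nodes with two children; for a node $u$, $B_u$ is the sub-DAG reachable from $u$ and $\mathsf{var}(B_u)$ the set of labels of its decision nodes; the variable sets below the two children of each conjunction node are disjoint and no path repeats a variable. Accepted assignments (maps to $\{0,1\}$ as sets of pairs): $\{\emptyset\}$ at ${\bf 1}$, $\emptyset$ at ${\bf 0}$, $\mathcal{A}(B_{u_0})\times\{(x,0)\}\cup\mathcal{A}(B_{u_1})\times\{(x,1)\}$ at a decision node labelled $x$, $\mathcal{A}(B_{u_0})\times\mathcal{A}(B_{u_1})$ at a conjunction node, where $\times$ is union of pairs over disjoint domains; $B$ represents $\psi(G)$ if $\mathsf{var}(B)=V(G^*)$ and the assignments extending accepted ones are exactly the satisfying assignments of $\psi(G)$. $B$ is a $\wedge_d$-OBDD obeying $\pi^*$ if decision labels increase in $\pi^*$ along every path. Alignment $B[{\bf g}]$: delete, for each decision node labelled $x\in\mathsf{var}({\bf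 g})$, its out-edge labelled $1-{\bf g}(x)$, then delete nodes unreachable from the source. A decision node of $B[{\bf g}]$ is incomplete if it has one outgoing edge there, complete otherwise. $L({\bf g})$ is the set of complete decision nodes $w$ of $B[{\bf g}]$ reachable from the source via a path of $B[{\bf g}]$ on which all decision nodes other than $w$ are incomplete. $\mathcal{F}$ is the set of assignments ${\bf g}$ with domain $\pi_0$ such that at least one variable of $U[1]$ is mapped to $0$, at least two variables of $U[1]$ are mapped to $1$, and all variables of $\pi_0\setminus U[1]$ are mapped to $1$. $I({\bf g})=\{i:{\bf g}(u_i[1])=1\}$ and $W[2]_J=\{w_j[2]:j\in J\}$. (For every ${\bf g}\in\mathcal{F}$ such a node $u({\bf g})$ exists.) -}

module Defs where

open import Data.Nat using (ℕ; _<_; _≤_)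
open import Data.Fin using (Fin)
open import Data.Bool using (Bool; true; false; _∨_; if_then_else_)
open import Data.Product using (Σ; ∃; _×_; _,_)
open import Data.Sum using (_⊎_)
open import Relation.Binary.PropositionalEquality using (_≡_; _≢_)
open import Relation.Nullary using (¬_)
open import Relation.Binary.Construct.Closure.ReflexiveTransitive using (Star)
open import Induction.WellFounded using (WellFounded)

record Graph : Set₁ where
  field
    n        : ℕ
    E        : Fin n → Fin n → Set
    E-sym    : ∀ {u v} → E u v → E v u
    E-irrefl : ∀ {v} → ¬ E v v
open Graph public

NoIsolated : Graph → Set
NoIsolated G = ∀ v → ∃ λ u → E G v u

-- G* : vertices V[1] ∪ V[2]; (c₁ , v) is v[1], (c₂ , v) is v[2]

data Copy : Set where
  c₁ c₂ : Copy

VS : Graph → Set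
VS G = Copy × Fin (n G)

data Adj* (G : Graph) : VS G → VS G → Set where
  e12 : ∀ {u v} → E G u v → Adj* G (c₁ , u) (c₂ , v)
  e21 : ∀ {u v} → E G u v → Adj* G (c₂ , u) (c₁ , v)

Satψ : (G : Graph) → (VS G → Bool) → Set
Satψ G f = (∀ a b → Adj* G a b → (f a ∨ f b) ≡ true)
         × (∃ λ v → f (c₁ , v) ≡ false)
         × (∃ λ v → f (c₂ , v) ≡ false)

data Kind (X : Set) (m : ℕ) : Set where
  sink0 sink1 : Kind X m
  dec  : X → Fin m → Fin m → Kind X m     -- dec x c₀ c₁ : out-edge 0 to c₀, 1 to c₁
  conj : Fin m → Fin m → Kind X m

record Diagram (X : Set) : Set where
  field
    m      : ℕ
    kind   : Fin m → Kind X m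
    source : Fin m
    zeroN  : Fin m
    oneN   : Fin m
open Diagram public

module _ {X : Set} (B : Diagram X) where

  data Child : Fin (m B) → Fin (m B) → Set where
    ch-dec₀  : ∀ {u x c₀ c₁} → kind B u ≡ dec x c₀ c₁ → Child u c₀
    ch-dec₁  : ∀ {u x c₀ c₁} → kind B u ≡ dec x c₀ c₁ → Child u c₁
    ch-conj₀ : ∀ {u c₀ c₁} → kind B u ≡ conj c₀ c₁ → Child u c₀
    ch-conj₁ : ∀ {u c₀ c₁} → kind B u ≡ conj c₀ c₁ → Child u c₁

  Reach : Fin (m B) → Fin (m B) → Set
  Reach = Star Child

  InVar : X → Fin (m B) → Set
  InVar x u = ∃ λ v → Reach u v × Σ (Fin (m B)) λ c₀ → Σ (Fin (m B)) λ c₁ → kind B v ≡ dec x c₀ c₁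

  -- a total assignment f extends some accepted assignment of B_u
  data Accepts (f : X → Bool) : Fin (m B) → Set where
    acc-one  : ∀ {u} → kind B u ≡ sink1 → Accepts f u
    acc-dec  : ∀ {u x c₀ c₁} → kind B u ≡ dec x c₀ c₁ →
               Accepts f (if f x then c₁ else c₀) → Accepts f u
    acc-conj : ∀ {u c₀ c₁} → kind B u ≡ conj c₀ c₁ →
               Accepts f c₀ → Accepts f c₁ → Accepts f u

  record IsAndFBDD : Set where
    field
      acyclic     : WellFounded (λ v u → Child u v)
      allFromSrc  : ∀ u → Reach (source B) u
      zero-sink   : kind B (zeroN B) ≡ sink0
      one-sink    : kind B (oneN B) ≡ sink1
      zero-unique : ∀ u → kind B u ≡ sink0 → u ≡ zeroN B
      one-unique  : ∀ u → kind B u ≡ sink1 → u ≡ oneN B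
      decomposable : ∀ u c₀ c₁ → kind B u ≡ conj c₀ c₁ →
                     ∀ x → InVar x c₀ → ¬ InVar x c₁
      read-once    : ∀ u x c₀ c₁ → kind B u ≡ dec x c₀ c₁ →
                     ¬ InVar x c₀ × ¬ InVar x c₁

  Obeys : (X → ℕ) → Set
  Obeys pos = ∀ u x c₀ c₁ → kind B u ≡ dec x c₀ c₁ →
              ∀ c → Child u c → ∀ y → InVar y c → pos x < pos y

Represents : (G : Graph) → Diagram (VS G) → Set
Represents G B = (∀ x → InVar B x (source B))
               × (∀ f → (Accepts B f (source B) → Satψ G f) × (Satψ G f → Accepts B f (source B)))

module _ (G : Graph) (q : ℕ) (u w : Fin q → Fin (n G)) where

  End : Fin q → VS G → Set
  End i a = a ≡ (c₁ , u i) ⊎ a ≡ (c₂ , w i)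

  InducedMatching : Set
  InducedMatching = (∀ i → Adj* G (c₁ , u i) (c₂ , w i))
                  × (∀ i j → i ≢ j → ∀ a b → End i a → End j b → a ≢ b × ¬ Adj* G a b)

  module _ (pos : VS G → ℕ) where

    -- x ∈ π₀ : prefix of π* ending with the last element of U[1]
    InPi0 : VS G → Set
    InPi0 x = ∃ λ i → pos x ≤ pos (c₁ , u i)

    InU1 : VS G → Set
    InU1 x = ∃ λ i → x ≡ (c₁ , u i)

    -- g ∈ 𝓕 (g : domain π₀, only values on π₀ matter)
    InF : (VS G → Bool) → Set
    InF g = (∃ λ i → g (c₁ , u i) ≡ false)
          × (∃ λ i → ∃ λ j → i ≢ j × g (c₁ , u i) ≡ true × g (c₁ , u j) ≡ true)
          × (∀ x → InPi0 x → ¬ InU1 x → g x ≡ true)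

    DistinctOnPi0 : (VS G → Bool) → (VS G → Bool) → Set
    DistinctOnPi0 g₁ g₂ = ∃ λ x → InPi0 x × g₁ x ≢ g₂ x

    module _ (B : Diagram (VS G)) (g : VS G → Bool) where

      -- the out-edge labelled b of a decision node labelled x survives in B[g]
      Kept : VS G → Bool → Set
      Kept x b = InPi0 x → b ≡ g x

      -- edges of B[g] (before removing unreachable nodes)
      data AEdge : Fin (m B) → Fin (m B) → Set where
        ae-dec₀  : ∀ {v x c₀ c₁} → kind B v ≡ dec x c₀ c₁ → Kept x false → AEdge v c₀
        ae-dec₁  : ∀ {v x c₀ c₁} → kind B v ≡ dec x c₀ c₁ → Kept x true → AEdge v c₁
        ae-conj₀ : ∀ {v c₀ c₁} → kind B v ≡ conj c₀ c₁ → AEdge v c₀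
        ae-conj₁ : ∀ {v c₀ c₁} → kind B v ≡ conj c₀ c₁ → AEdge v c₁

      CompleteDec : Fin (m B) → Set
      CompleteDec v = Σ (VS G) λ x → Σ (Fin (m B)) λ c₀ → Σ (Fin (m B)) λ c₁ →
                      kind B v ≡ dec x c₀ c₁ × Kept x false × Kept x true

      IncompleteIfDec : Fin (m B) → Set
      IncompleteIfDec v = ∀ x c₀ c₁ → kind B v ≡ dec x c₀ c₁ → ¬ (Kept x false × Kept x true)

      data IPath : Fin (m B) → Fin (m B) → Set where
        ip-here : ∀ {t} → IPath t t
        ip-step : ∀ {v v' t} → AEdge v v' → IncompleteIfDec v → IPath v' t → IPath v t

      InL : Fin (m B) → Set
      InL t = CompleteDec t × IPath (source B) t

      WCover : Fin (m B) → Set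
      WCover t = ∀ i → g (c₁ , u i) ≡ true → InVar B (c₂ , w i) t

-- Suppose t ∈ L(g₁) ∩ L(g₂) with g₁(u_i[1]) = 1 and g₂(u_i[1]) = 0. Extend each gⱼ
-- to a model fⱼ of ψ(G) that sets w_k[2] to 0 exactly for k ∈ I(gⱼ) and every other
-- variable outside π₀ to 1. Following the incomplete path of B[g₁], B_t accepts f₁;
-- no variable below the complete node t lies in π₀ (the order is π*), so B_t also
-- accepts h := g₂ on π₀, f₁ elsewhere. Since W[2]_{I(gⱼ)} ⊆ var(B_t), h agrees with f₂
-- outside var(B_t), and decomposability lets us graft the run of B_t on h into the run
-- of B on f₂ along the incomplete path of B[g₂]. So h ⊨ ψ(G), although
-- h(u_i[1]) = g₂(u_i[1]) = 0 and h(w_i[2]) = f₁(w_i[2]) = 0 falsify the clause of the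
-- matching edge {u_i[1], w_i[2]}.
module Submission where

open import Defs
open import Data.Nat using (ℕ; _<_; _≤_; _≤?_)
open import Data.Nat.Properties using (≤-refl; ≤-trans; <⇒≤; <⇒≱)
open import Data.Fin as Fin using (Fin)
open import Data.Fin.Properties using (any?)
open import Data.Bool using (Bool; true; false; _∨_; if_then_else_)
import Data.Bool.Properties as Bool
open import Data.Product using (∃; _×_; _,_; proj₁; proj₂)
open import Data.Product.Properties using (≡-dec)
open import Data.Sum using (inj₁; inj₂)
open import Data.Unit using (⊤; tt)
open import Data.Empty using (⊥)
open import Function using (const; case_of_; mk⇔)
open import Relation.Unary using (Decidable)
open import Relation.Nullary using (¬_; Dec; yes; no; does; contradiction)
open import Relation.Nullary.Decidable using (dec-true; dec-false; _×-dec_)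
open import Relation.Binary.PropositionalEquality using (_≡_; _≢_; refl; sym; trans; subst)
open import Relation.Binary.Construct.Closure.ReflexiveTransitive using (Star; ε; _◅_; _◅◅_)
open import Function.Definitions using (Injective)

module _ {A : Set} {P : A → Set} (P? : Decidable P) where

  select : (A → Bool) → (A → Bool) → A → Bool
  select f g x = if does (P? x) then f x else g x

  select-∈ : ∀ f g {x} → P x → select f g x ≡ f x
  select-∈ _ _ {x} p rewrite dec-true (P? x) p = refl

  select-∉ : ∀ f g {x} → ¬ P x → select f g x ≡ g x
  select-∉ _ _ {x} ¬p rewrite dec-false (P? x) ¬p = refl

module _ {X : Set} (B : Diagram X) where

  InVar-reach : ∀ {x v c} → Reach B v c → InVar B x c → InVar B x v
  InVar-reach r (z , r′ , d) = z , r ◅◅ r′ , d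

  data Step (f : X → Bool) : Fin (m B) → Fin (m B) → Set where
    step-dec   : ∀ {v x c₀ c₁} → kind B v ≡ dec x c₀ c₁ → Step f v (if f x then c₁ else c₀)
    step-conj₀ : ∀ {v c₀ c₁} → kind B v ≡ conj c₀ c₁ → Step f v c₀
    step-conj₁ : ∀ {v c₀ c₁} → kind B v ≡ conj c₀ c₁ → Step f v c₁

  Step⇒Child : ∀ {f v c} → Step f v c → Child B v c
  Step⇒Child {f} (step-dec {x = x} e) with f x
  ... | true  = ch-dec₁ e
  ... | false = ch-dec₀ e
  Step⇒Child (step-conj₀ e) = ch-conj₀ e
  Step⇒Child (step-conj₁ e) = ch-conj₁ e

  Accepts-local : ∀ {f f′ v} → (∀ x → InVar B x v → f x ≡ f′ x) → Accepts B f v → Accepts B f′ v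
  Accepts-local agree (acc-one e) = acc-one e
  Accepts-local {f} {f′} agree (acc-dec {x = x} {k₀} {k₁} e a) =
    acc-dec e (subst (λ b → Accepts B f′ (if b then k₁ else k₀)) (agree x (_ , ε , k₀ , k₁ , e))
      (Accepts-local (λ y iv → agree y (InVar-reach (Step⇒Child (step-dec {f = f} e) ◅ ε) iv)) a))
  Accepts-local agree (acc-conj e a₀ a₁) =
    acc-conj e (Accepts-local (λ y iv → agree y (InVar-reach (ch-conj₀ e ◅ ε) iv)) a₀)
               (Accepts-local (λ y iv → agree y (InVar-reach (ch-conj₁ e ◅ ε) iv)) a₁)

  AcceptsAt : (X → Bool) → Kind X (m B) → Set
  AcceptsAt f sink0          = ⊥
  AcceptsAt f sink1          = ⊤
  AcceptsAt f (dec x k₀ k₁)  = Accepts B f (if f x then k₁ else k₀)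
  AcceptsAt f (conj k₀ k₁)   = Accepts B f k₀ × Accepts B f k₁

  Accepts-unfold : ∀ {f v} → Accepts B f v → AcceptsAt f (kind B v)
  Accepts-unfold (acc-one e)        rewrite e = tt
  Accepts-unfold (acc-dec e a)      rewrite e = a
  Accepts-unfold (acc-conj e a₀ a₁) rewrite e = a₀ , a₁

  Steps⇒Reach : ∀ {f v t} → Star (Step f) v t → Reach B v t
  Steps⇒Reach ε       = ε
  Steps⇒Reach (s ◅ p) = Step⇒Child s ◅ Steps⇒Reach p

  Accepts-step : ∀ {f v c} → Step f v c → Accepts B f v → Accepts B f c
  Accepts-step {f} (step-dec e)   a = subst (AcceptsAt f) e (Accepts-unfold a)
  Accepts-step {f} (step-conj₀ e) a = proj₁ (subst (AcceptsAt f) e (Accepts-unfold a))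
  Accepts-step {f} (step-conj₁ e) a = proj₂ (subst (AcceptsAt f) e (Accepts-unfold a))

  Accepts-steps : ∀ {f v t} → Star (Step f) v t → Accepts B f v → Accepts B f t
  Accepts-steps ε       a = a
  Accepts-steps (s ◅ p) a = Accepts-steps p (Accepts-step s a)

  Obeys⇒label≤ : ∀ {pos : X → ℕ} {t x c₀ c₁ y} → Obeys B pos → kind B t ≡ dec x c₀ c₁ →
                 InVar B y t → pos x ≤ pos y
  Obeys⇒label≤ ob e (v , ε , _ , _ , e′) with trans (sym e) e′
  ... | refl = ≤-refl
  Obeys⇒label≤ ob e (v , ch ◅ r , d) = <⇒≤ (ob _ _ _ _ e _ ch _ (v , r , d))

  module _ (fbdd : IsAndFBDD B) where
    open IsAndFBDD fbdd

    Accepts-unstep : ∀ {f h v c t} → Step f v c → Reach B c t →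
                     (∀ x → ¬ InVar B x t → f x ≡ h x) →
                     Accepts B f v → Accepts B h c → Accepts B h v
    Accepts-unstep {f} {h} {v} (step-dec {x = x} {k₀} {k₁} e) r agree _ a =
      acc-dec e (subst (λ b → Accepts B h (if b then k₁ else k₀)) (agree x x∉t) a)
      where
      x∉chosen : ∀ b → ¬ InVar B x (if b then k₁ else k₀)
      x∉chosen true  = proj₂ (read-once v x k₀ k₁ e)
      x∉chosen false = proj₁ (read-once v x k₀ k₁ e)
      x∉t : ¬ InVar B x _
      x∉t x∈t = x∉chosen (f x) (InVar-reach r x∈t)
    Accepts-unstep {f} {v = v} (step-conj₀ {c₀ = k₀} {c₁ = k₁} e) r agree a a₀ =
      acc-conj e a₀ (Accepts-local (λ x x∈k₁ → agree x (λ x∈t →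
        decomposable v k₀ k₁ e x (InVar-reach r x∈t) x∈k₁))
        (proj₂ (subst (AcceptsAt f) e (Accepts-unfold a))))
    Accepts-unstep {f} {v = v} (step-conj₁ {c₀ = k₀} {c₁ = k₁} e) r agree a a₁ =
      acc-conj e (Accepts-local (λ x x∈k₀ → agree x (λ x∈t →
        decomposable v k₀ k₁ e x x∈k₀ (InVar-reach r x∈t)))
        (proj₁ (subst (AcceptsAt f) e (Accepts-unfold a)))) a₁

    Accepts-graft : ∀ {f h v t} → Star (Step f) v t →
                    (∀ x → ¬ InVar B x t → f x ≡ h x) →
                    Accepts B f v → Accepts B h t → Accepts B h v
    Accepts-graft ε       agree a at = at
    Accepts-graft (s ◅ p) agree a at =
      Accepts-unstep s (Steps⇒Reach p) agree a (Accepts-graft p agree (Accepts-step s a) at)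

copy-≟ : (a b : Copy) → Dec (a ≡ b)
copy-≟ c₁ c₁ = yes refl
copy-≟ c₁ c₂ = no λ ()
copy-≟ c₂ c₁ = no λ ()
copy-≟ c₂ c₂ = yes refl

module _ (G : Graph) (q : ℕ) (u w : Fin q → Fin (n G)) (pos : VS G → ℕ) where

  private
    π₀ : VS G → Set
    π₀ = InPi0 G q u w pos

  _≟_ : (a b : VS G) → Dec (a ≡ b)
  _≟_ = ≡-dec copy-≟ Fin._≟_

  π₀? : Decidable π₀
  π₀? x = any? λ i → pos x ≤? pos (c₁ , u i)

  U₁? : Decidable (InU1 G q u w pos)
  U₁? x = any? λ i → x ≟ (c₁ , u i)

  InW₂I : (VS G → Bool) → VS G → Set
  InW₂I g x = ∃ λ j → x ≡ (c₂ , w j) × g (c₁ , u j) ≡ true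

  InW₂I? : ∀ g → Decidable (InW₂I g)
  InW₂I? g x = any? λ j → (x ≟ (c₂ , w j)) ×-dec (g (c₁ , u j) Bool.≟ true)

  W₂∉π₀ : (∀ i j → pos (c₁ , u i) < pos (c₂ , w j)) → ∀ j → ¬ π₀ (c₂ , w j)
  W₂∉π₀ U₁<W₂ j (k , le) = <⇒≱ (U₁<W₂ k j) le

  -- Opaque so that g is recovered by unification from extend g x.
  opaque
    extend-off : (VS G → Bool) → VS G → Bool
    extend-off g = select (InW₂I? g) (const false) (const true)

    extend : (VS G → Bool) → VS G → Bool
    extend g = select π₀? g (extend-off g)

    extend-π₀ : ∀ {g x} → π₀ x → extend g x ≡ g x
    extend-π₀ {g} = select-∈ π₀? g (extend-off g)

    extend-W₂I : ∀ {g x} → ¬ π₀ x → InW₂I g x → extend g x ≡ false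
    extend-W₂I {g} x∉π₀ x∈W = trans (select-∉ π₀? g (extend-off g) x∉π₀) (select-∈ (InW₂I? g) _ _ x∈W)

    extend-other : ∀ {g x} → ¬ π₀ x → ¬ InW₂I g x → extend g x ≡ true
    extend-other {g} x∉π₀ x∉W = trans (select-∉ π₀? g (extend-off g) x∉π₀) (select-∉ (InW₂I? g) _ _ x∉W)

  module _ {g : VS G → Bool} (F : InF G q u w pos g) where

    private
      off-U₁-true : ∀ x → π₀ x → ¬ InU1 G q u w pos x → g x ≡ true
      off-U₁-true = proj₂ (proj₂ F)

    extend-false-V₁ : ∀ {x} → extend g (c₁ , x) ≡ false →
                      ∃ λ k → (c₁ , x) ≡ (c₁ , u k) × g (c₁ , u k) ≡ false
    extend-false-V₁ {x} e = case π₀? (c₁ , x) of λ where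
      (no x∉π₀) → contradiction (trans (sym e) (extend-other x∉π₀ λ { (_ , () , _) })) λ ()
      (yes x∈π₀) → case U₁? (c₁ , x) of λ where
        (yes (k , x≡uk)) → k , x≡uk , subst (λ y → g y ≡ false) x≡uk (trans (sym (extend-π₀ x∈π₀)) e)
        (no x∉U₁) → contradiction (trans (sym e) (trans (extend-π₀ x∈π₀) (off-U₁-true _ x∈π₀ x∉U₁))) λ ()

    extend-false-V₂ : ∀ {y} → extend g (c₂ , y) ≡ false → InW₂I g (c₂ , y)
    extend-false-V₂ {y} e = case π₀? (c₂ , y) of λ where
      (yes y∈π₀) → contradiction
        (trans (sym e) (trans (extend-π₀ y∈π₀) (off-U₁-true _ y∈π₀ λ { (_ , ()) }))) λ ()
      (no y∉π₀) → case InW₂I? g (c₂ , y) of λ where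
        (yes y∈W) → y∈W
        (no y∉W) → contradiction (trans (sym e) (extend-other y∉π₀ y∉W)) λ ()

    module _ (IM : InducedMatching G q u w) (U₁<W₂ : ∀ i j → pos (c₁ , u i) < pos (c₂ , w j)) where

      extend-edge : ∀ {x y} → E G x y → (extend g (c₁ , x) ∨ extend g (c₂ , y)) ≡ true
      extend-edge {x} {y} xy with extend g (c₁ , x) in e₁ | extend g (c₂ , y) in e₂
      ... | true  | _    = refl
      ... | false | true = refl
      ... | false | false
        with extend-false-V₁ e₁ | extend-false-V₂ e₂
      ... | k , x≡uk , gk | j , y≡wj , gj =
        contradiction (e12 xy) (proj₂ (proj₂ IM k j k≢j _ _ (inj₁ x≡uk) (inj₂ y≡wj)))
        where
        k≢j : k ≢ j
        k≢j refl = contradiction (trans (sym gk) gj) λ ()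

      extend-satisfies : Satψ G (extend g)
      extend-satisfies =
        let (k₀ , gk₀) , (j₀ , _ , _ , gj₀ , _) , _ = F in
        clauses , (u k₀ , trans (extend-π₀ (k₀ , ≤-refl)) gk₀)
                , (w j₀ , extend-W₂I (W₂∉π₀ U₁<W₂ j₀) (j₀ , refl , gj₀))
        where
        clauses : ∀ a b → Adj* G a b → (extend g a ∨ extend g b) ≡ true
        clauses _ _ (e12 xy) = extend-edge xy
        clauses (_ , y) (_ , x) (e21 yx) =
          trans (Bool.∨-comm (extend g (c₂ , y)) (extend g (c₁ , x))) (extend-edge (G .E-sym yx))

  module _ (B : Diagram (VS G)) (g : VS G → Bool) where

    Extends : (VS G → Bool) → Set
    Extends f = ∀ x → π₀ x → f x ≡ g x

    incomplete-forced : ∀ {f v x c₀ c₁ b} → Extends f → kind B v ≡ dec x c₀ c₁ →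
                        Kept G q u w pos B g x b → IncompleteIfDec G q u w pos B g v → f x ≡ b
    incomplete-forced {x = x} {c₀ = k₀} {c₁ = k₁} ext e kept inc with π₀? x
    ... | yes x∈π₀ = trans (ext x x∈π₀) (sym (kept x∈π₀))
    ... | no x∉π₀  = contradiction ((λ x∈π₀ → contradiction x∈π₀ x∉π₀) , (λ x∈π₀ → contradiction x∈π₀ x∉π₀))
                                   (inc x k₀ k₁ e)

    AEdge⇒Step : ∀ {f v v′} → Extends f → AEdge G q u w pos B g v v′ →
                 IncompleteIfDec G q u w pos B g v → Step B f v v′
    AEdge⇒Step {f} {v} ext (ae-dec₀ {c₀ = k₀} {c₁ = k₁} e kept) inc =
      subst (λ b → Step B f v (if b then k₁ else k₀)) (incomplete-forced ext e kept inc) (step-dec e)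
    AEdge⇒Step {f} {v} ext (ae-dec₁ {c₀ = k₀} {c₁ = k₁} e kept) inc =
      subst (λ b → Step B f v (if b then k₁ else k₀)) (incomplete-forced ext e kept inc) (step-dec e)
    AEdge⇒Step ext (ae-conj₀ e) inc = step-conj₀ e
    AEdge⇒Step ext (ae-conj₁ e) inc = step-conj₁ e

    IPath⇒Steps : ∀ {f v t} → Extends f → IPath G q u w pos B g v t → Star (Step B f) v t
    IPath⇒Steps ext ip-here            = ε
    IPath⇒Steps ext (ip-step e inc p) = AEdge⇒Step ext e inc ◅ IPath⇒Steps ext p

    complete⇒var∉π₀ : ∀ {t y} → Obeys B pos → CompleteDec G q u w pos B g t → InVar B y t → ¬ π₀ y
    complete⇒var∉π₀ ob (x , k₀ , k₁ , e , kept₀ , kept₁) y∈t (k , y≤uk) =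
      contradiction (trans (kept₀ x∈π₀) (sym (kept₁ x∈π₀))) λ ()
      where
      x∈π₀ : π₀ x
      x∈π₀ = k , ≤-trans (Obeys⇒label≤ B ob e y∈t) y≤uk

  module _ (B : Diagram (VS G)) (fbdd : IsAndFBDD B) (rep : Represents G B) (ob : Obeys B pos)
           (IM : InducedMatching G q u w) (U₁<W₂ : ∀ i j → pos (c₁ , u i) < pos (c₂ , w j)) where

    shared-node⇒I-⊆ : ∀ {g₁ g₂ t} → InF G q u w pos g₁ → InF G q u w pos g₂ →
                      InL G q u w pos B g₁ t → WCover G q u w pos B g₁ t →
                      InL G q u w pos B g₂ t → WCover G q u w pos B g₂ t →
                      ∀ i → g₁ (c₁ , u i) ≡ true → g₂ (c₁ , u i) ≡ true
    shared-node⇒I-⊆ {g₁} {g₂} {t} F₁ F₂ (complete₁ , path₁) cover₁ (_ , path₂) cover₂ i g₁i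
      with g₂ (c₁ , u i) in g₂i
    ... | true  = refl
    ... | false = contradiction (proj₁ h-satisfies _ _ (proj₁ IM i)) (false∨false≢true h-ui h-wi)
      where
      f₁ f₂ h : VS G → Bool
      f₁ = extend g₁
      f₂ = extend g₂
      h  = select π₀? g₂ f₁

      accepts : ∀ {g} → InF G q u w pos g → Accepts B (extend g) (source B)
      accepts F = proj₂ (proj₂ rep _) (extend-satisfies F IM U₁<W₂)

      f₁-at-t : Accepts B f₁ t
      f₁-at-t = Accepts-steps B (IPath⇒Steps B g₁ (λ _ → extend-π₀) path₁) (accepts F₁)

      h-at-t : Accepts B h t
      h-at-t = Accepts-local B
        (λ x x∈t → sym (select-∉ π₀? g₂ f₁ (complete⇒var∉π₀ B g₁ ob complete₁ x∈t))) f₁-at-t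

      W₂I⊆var : ∀ {g} → WCover G q u w pos B g t → ∀ {x} → InW₂I g x → InVar B x t
      W₂I⊆var cover (j , refl , gj) = cover j gj

      f₂≡h-off-t : ∀ x → ¬ InVar B x t → f₂ x ≡ h x
      f₂≡h-off-t x x∉t = case π₀? x of λ where
        (yes x∈π₀) → trans (extend-π₀ x∈π₀) (sym (select-∈ π₀? g₂ f₁ x∈π₀))
        (no x∉π₀) → trans (extend-other x∉π₀ (λ x∈W → x∉t (W₂I⊆var {g₂} cover₂ x∈W)))
          (sym (trans (select-∉ π₀? g₂ f₁ x∉π₀) (extend-other x∉π₀ (λ x∈W → x∉t (W₂I⊆var {g₁} cover₁ x∈W)))))

      h-satisfies : Satψ G h
      h-satisfies = proj₁ (proj₂ rep h)
        (Accepts-graft B fbdd (IPath⇒Steps B g₂ (λ _ → extend-π₀) path₂) f₂≡h-off-t (accepts F₂) h-at-t)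

      h-ui : h (c₁ , u i) ≡ false
      h-ui = trans (select-∈ π₀? g₂ f₁ (i , ≤-refl)) g₂i

      h-wi : h (c₂ , w i) ≡ false
      h-wi = trans (select-∉ π₀? g₂ f₁ wi∉π₀) (extend-W₂I wi∉π₀ (i , refl , g₁i))
        where
        wi∉π₀ : ¬ π₀ (c₂ , w i)
        wi∉π₀ = W₂∉π₀ U₁<W₂ i

      false∨false≢true : ∀ {a b} → a ≡ false → b ≡ false → (a ∨ b) ≢ true
      false∨false≢true refl refl ()

    shared-node⇒agree-on-U₁ : ∀ {g₁ g₂ t} → InF G q u w pos g₁ → InF G q u w pos g₂ →
                              InL G q u w pos B g₁ t → WCover G q u w pos B g₁ t →
                              InL G q u w pos B g₂ t → WCover G q u w pos B g₂ t →
                              ∀ i → g₁ (c₁ , u i) ≡ g₂ (c₁ , u i)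
    shared-node⇒agree-on-U₁ F₁ F₂ L₁ C₁ L₂ C₂ i = Bool.⇔→≡ {z = true}
      (mk⇔ (shared-node⇒I-⊆ F₁ F₂ L₁ C₁ L₂ C₂ i) (shared-node⇒I-⊆ F₂ F₁ L₂ C₂ L₁ C₁ i))

lemma10 : (G : Graph) → NoIsolated G →
    (B : Diagram (VS G)) → IsAndFBDD B → Represents G B →
    (pos : VS G → ℕ) → Injective _≡_ _≡_ pos → Obeys B pos →
    (q : ℕ) (u w : Fin q → Fin (n G)) →
    InducedMatching G q u w →
    (∀ i j → pos (c₁ , u i) < pos (c₂ , w j)) →
    (g₁ g₂ : VS G → Bool) →
    InF G q u w pos g₁ → InF G q u w pos g₂ → DistinctOnPi0 G q u w pos g₁ g₂ →
    (t₁ t₂ : Fin (m B)) →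
    InL G q u w pos B g₁ t₁ → WCover G q u w pos B g₁ t₁ →
    InL G q u w pos B g₂ t₂ → WCover G q u w pos B g₂ t₂ →
    t₁ ≢ t₂
lemma10 G _ B fbdd rep pos _ ob q u w IM U₁<W₂ g₁ g₂ F₁ F₂ (x , x∈π₀ , g₁x≢g₂x) t .t L₁ C₁ L₂ C₂ refl
  with U₁? G q u w pos x
... | no x∉U₁ = g₁x≢g₂x (trans (proj₂ (proj₂ F₁) x x∈π₀ x∉U₁) (sym (proj₂ (proj₂ F₂) x x∈π₀ x∉U₁)))
... | yes (i , refl) =
  g₁x≢g₂x (shared-node⇒agree-on-U₁ G q u w pos B fbdd rep ob IM U₁<W₂ F₁ F₂ L₁ C₁ L₂ C₂ i)
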